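{- Let $t$ be a power of $2$, let $k = 1+\log_2 t$ and $h = 4t - 2\log_2 t - 4$. There exists a quantum gate $U_{1s}$ that, on the input basis state $\ket{b_0\dots b_{t-1}}\ket{0_h}\ket{0_k}$ with $b_0,\dots,b_{t-1}\in\{0,1\}$, produces the output $\ket{b_0\dots b_{t-1}}\ket{0_h}\ket{s}$, where $s$ is the binary representation, in $\log_2 t+1$ bits, of $\sum_{i=0}^{t-1} b_i$. The gate $U_{1s}$ has $O(t)$ circuit complexity, $O(\log^2 t)$ depth, and $O(t)$ width.
   Context: $\ket{0_k}$ denotes $k$ qubits all in state $\ket{0}$. Quantum circuits are composed of elementary gates (single-qubit gates, CNOT, Toffoli gates on a constant number of qubits). A circuit is modeled as a vertex-weighted DAG whose vertices are its gates, each weighted by the number of elementary gates needed to build it, and whose directed edges represent qubit input-output dependencies. The circuit complexity is the number of elementary gates; the depth is the number of vertices on a longest directed path of this DAG; the width is the maximum total weight of an anti-chain (a maximal set of pairwise incomparable vertices). -}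

module Defs where

open import Data.Bool using (Bool; true; false; not; _∧_; _xor_; if_then_else_)
open import Data.Nat using (ℕ; zero; suc; _+_; _*_; _∸_; _^_; _≤_; _<_; _/_; _%_; _≡ᵇ_)
open import Data.Fin using (Fin; toℕ)
open import Data.Vec using (Vec; []; _∷_; _∷ʳ_; _[_]%=_)
import Data.Vec as Vec
open import Data.List using (List; length)
import Data.List as List
open import Data.List.Membership.Propositional using (_∈_; _∉_)
open import Data.List.Relation.Unary.Unique.Propositional using (Unique)
open import Data.List.Relation.Unary.Linked using (Linked)
open import Data.Product using (Σ; ∃; _×_)
open import Relation.Binary.Construct.Closure.Transitive using (TransClosure)
open import Relation.Binary.PropositionalEquality using (_≡_; _≢_)
open import Relation.Nullary using (¬_)

data Gate (n : ℕ) : Set where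
  X       : Fin n → Gate n
  CNOT    : (c tg : Fin n) → c ≢ tg → Gate n
  Toffoli : (c₁ c₂ tg : Fin n) → c₁ ≢ c₂ → c₁ ≢ tg → c₂ ≢ tg → Gate n

-- A circuit is a sequence of elementary gates; the head is applied first.
Circuit : ℕ → Set
Circuit n = List (Gate n)

qubits : ∀ {n} → Gate n → List (Fin n)
qubits (X q) = q List.∷ List.[]
qubits (CNOT c tg _) = c List.∷ tg List.∷ List.[]
qubits (Toffoli c₁ c₂ tg _ _ _) = c₁ List.∷ c₂ List.∷ tg List.∷ List.[]

-- action of a gate on a computational basis state
applyGate : ∀ {n} → Gate n → Vec Bool n → Vec Bool n
applyGate (X q) s = s [ q ]%= not
applyGate (CNOT c tg _) s = s [ tg ]%= (λ x → x xor Vec.lookup s c)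
applyGate (Toffoli c₁ c₂ tg _ _ _) s = s [ tg ]%= (λ x → x xor (Vec.lookup s c₁ ∧ Vec.lookup s c₂))

run : ∀ {n} → Circuit n → Vec Bool n → Vec Bool n
run List.[] s = s
run (g List.∷ c) s = run c (applyGate g s)

complexity : ∀ {n} → Circuit n → ℕ
complexity = length

gateAt : ∀ {n} (c : Circuit n) → Fin (length c) → Gate n
gateAt c i = List.lookup c i

-- DAG edge i → j: some qubit q is an output of gate i and the next gate acting
-- on q after i is gate j (qubit input-output dependency)
Edge : ∀ {n} (c : Circuit n) → Fin (length c) → Fin (length c) → Set
Edge {n} c i j = Σ (Fin n) λ q →
  (q ∈ qubits (gateAt c i)) × (q ∈ qubits (gateAt c j)) × (toℕ i < toℕ j) ×
  (∀ (l : Fin (length c)) → toℕ i < toℕ l → toℕ l < toℕ j → q ∉ qubits (gateAt c l))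

Reach : ∀ {n} (c : Circuit n) → Fin (length c) → Fin (length c) → Set
Reach c = TransClosure (Edge c)

DepthAtMost : ∀ {n} → Circuit n → ℕ → Set
DepthAtMost c d = ∀ (p : List (Fin (length c))) → Linked (Edge c) p → length p ≤ d

Antichain : ∀ {n} (c : Circuit n) → List (Fin (length c)) → Set
Antichain c S = Unique S × (∀ {i j} → i ∈ S → j ∈ S → ¬ Reach c i j)

-- width ≤ w : every anti-chain has total weight (each elementary gate weighs 1) at most w
WidthAtMost : ∀ {n} → Circuit n → ℕ → Set
WidthAtMost c w = ∀ (S : List (Fin (length c))) → Antichain c S → length S ≤ w

popcount : ∀ {t} → Vec Bool t → ℕ
popcount [] = 0
popcount (b ∷ bs) = (if b then 1 else 0) + popcount bs

-- binary representation of m in k bits, most significant bit first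
toBits : (k : ℕ) → ℕ → Vec Bool k
toBits zero m = []
toBits (suc k) m = toBits k (m / 2) ∷ʳ (m % 2 ≡ᵇ 1)

-- parameters for t = 2^m : log₂ t = m
tOf : ℕ → ℕ
tOf m = 2 ^ m

kOf : ℕ → ℕ
kOf m = 1 + m

hOf : ℕ → ℕ
hOf m = 4 * 2 ^ m ∸ 2 * m ∸ 4

-- The t = 2^m input bits are summed by a balanced binary tree of ripple-carry adders: the t/2^(j+1) adders
-- joining subtrees of height j add (j+1)-bit numbers with O(j) gates and depth O(j). Hence O(t) gates in
-- all, and since the adders of one height act on disjoint wires, depth Σ_{j<m} O(j) = O(m²). The partial
-- sums and carries live in the 4t − 2m − 4 ancillas; the root's sum is copied out by CNOTs and the tree is
-- run backwards, which resets every ancilla because each gate is an involution and the copy does not touch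
-- the tree's wires. Depth is measured by the as-soon-as-possible level of each wire, and the width is at
-- most the number of gates.

module Submission where

open import Defs

module AdderTree where

  open import Data.Bool using (Bool; true; false; not; _∧_; _xor_; if_then_else_)
  open import Data.Bool.Properties using (xor-assoc; xor-same; xor-identityʳ)
  open import Data.Fin using (Fin; zero; suc; toℕ; _↑ˡ_; _↑ʳ_)
  import Data.Fin as Fin
  import Data.Fin.Properties as Fin
  open import Data.List using (List; []; _∷_; _++_; reverse; length)
  import Data.List as List
  import Data.List.Properties as List
  open import Data.List.Extrema.Nat using (max; xs≤max; max≤v⁺)
  import Data.List.Membership.DecPropositional as DecMembership
  open import Data.List.Membership.Propositional using (_∈_; _∉_)
  open import Data.List.Membership.Propositional.Properties using (∈-map⁺; ∈-lookup)
  open import Data.List.Relation.Unary.All as All using (All; []; _∷_)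
  open import Data.List.Relation.Unary.All.Properties as All using ()
  open import Data.List.Relation.Unary.AllPairs using (_∷_)
  open import Data.List.Relation.Unary.Any using (here; there)
  import Data.List.Relation.Unary.Any.Properties as Any
  open import Data.List.Relation.Unary.Linked using (Linked; []; [-]; _∷_)
  open import Data.List.Relation.Unary.Unique.Propositional using (Unique)
  open import Data.Nat using (ℕ; zero; suc; _+_; _*_; _∸_; _^_; _/_; _%_; _≡ᵇ_; _⊔_; _≤_; _<_; _≤?_; z≤n; s≤s)
  open import Data.Nat.DivMod using (m≡m%n+[m/n]*n; m%n<n; [m+kn]%n≡m%n; +-distrib-/-∣ʳ; m<n⇒m/n≡0; m*n/n≡m; m<n*o⇒m/o<n)
  open import Data.Nat.Divisibility using (n∣m*n)
  open import Data.Nat.Properties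
  open import Data.Nat.Tactic.RingSolver using (solve-∀)
  open import Data.Product using (_×_; _,_; proj₂; Σ; ∃)
  open import Data.Sum using (_⊎_; inj₁; inj₂)
  open import Data.Vec using (Vec; []; _∷_; _∷ʳ_; lookup)
  import Data.Vec as Vec
  import Data.Vec.Properties as Vec
  open import Function using (_∘_)
  open import Function.Definitions using (Injective)
  open import Relation.Binary.PropositionalEquality
  open import Relation.Nullary using (¬_; yes; no; contradiction)
  open import Relation.Unary using (_⊆_)

  vec-ext : ∀ {A : Set} {n} (u v : Vec A n) → (∀ i → lookup u i ≡ lookup v i) → u ≡ v
  vec-ext u v u≗v = trans (sym (Vec.tabulate∘lookup u)) (trans (Vec.tabulate-cong u≗v) (Vec.tabulate∘lookup v))

  xor-cancelʳ : ∀ x y → (x xor y) xor y ≡ x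
  xor-cancelʳ x y = trans (xor-assoc x y y) (trans (cong (x xor_) (xor-same y)) (xor-identityʳ x))

  ≡-++ : ∀ {A : Set} {m n} (xs : Vec A (m + n)) (u : Vec A m) (v : Vec A n) →
         (∀ i → lookup xs (i ↑ˡ n) ≡ lookup u i) → (∀ j → lookup xs (m ↑ʳ j) ≡ lookup v j) → xs ≡ u Vec.++ v
  ≡-++ {m = m} xs u v onˡ onʳ with Vec.splitAt m xs
  ... | xsˡ , xsʳ , refl = cong₂ Vec._++_
    (vec-ext xsˡ u λ i → trans (sym (Vec.lookup-++ˡ xsˡ xsʳ i)) (onˡ i))
    (vec-ext xsʳ v λ j → trans (sym (Vec.lookup-++ʳ xsˡ xsʳ j)) (onʳ j))

  ≡-++-++ : ∀ {A : Set} {m n p} (xs : Vec A (m + (n + p))) (u : Vec A m) (v : Vec A n) (w : Vec A p) →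
    (∀ i → lookup xs (i ↑ˡ (n + p)) ≡ lookup u i) → (∀ j → lookup xs (m ↑ʳ (j ↑ˡ p)) ≡ lookup v j) →
    (∀ l → lookup xs (m ↑ʳ (n ↑ʳ l)) ≡ lookup w l) → xs ≡ u Vec.++ v Vec.++ w
  ≡-++-++ {m = m} {n} {p} xs u v w onᵘ onᵛ onʷ with Vec.splitAt m xs
  ... | xsˡ , xsʳ , refl = cong₂ Vec._++_
    (vec-ext xsˡ u λ i → trans (sym (Vec.lookup-++ˡ xsˡ xsʳ i)) (onᵘ i))
    (≡-++ xsʳ v w (λ j → trans (sym (Vec.lookup-++ʳ xsˡ xsʳ (j ↑ˡ p))) (onᵛ j))
                  (λ l → trans (sym (Vec.lookup-++ʳ xsˡ xsʳ (n ↑ʳ l))) (onʷ l)))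

  ≤-by-slack : ∀ {a b} c → a + c ≡ b → a ≤ b
  ≤-by-slack {a} c a+c≡b = subst (a ≤_) a+c≡b (m≤m+n a c)

  ↑ˡ≢↑ʳ : ∀ {m n} (i : Fin m) (j : Fin n) → i ↑ˡ n ≢ m ↑ʳ j
  ↑ˡ≢↑ʳ {m} {n} i j i≡j = <⇒≢ (≤-trans (Fin.toℕ<n i) (m≤m+n m (toℕ j)))
    (trans (sym (Fin.toℕ-↑ˡ i n)) (trans (cong toℕ i≡j) (Fin.toℕ-↑ʳ m j)))

  not≡xor-true : ∀ x → not x ≡ x xor true
  not≡xor-true false = refl
  not≡xor-true true = refl

  parity : List Bool → Bool
  parity = List.foldr _xor_ false

  Linked-length≤ : ∀ {A : Set} {R : A → A → Set} (f : A → ℕ) {D} →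
    (∀ {x y} → R x y → f x < f y) → (∀ x → f x ≤ D) → ∀ {x xs} → Linked R (x ∷ xs) → length xs + f x ≤ D
  Linked-length≤ f increasing bounded {x} [-] = bounded x
  Linked-length≤ f {D} increasing bounded {x} {y ∷ xs} (xRy ∷ linked) = begin
    suc (length xs) + f x ≡⟨ +-suc (length xs) (f x) ⟨
    length xs + suc (f x) ≤⟨ +-monoʳ-≤ (length xs) (increasing xRy) ⟩
    length xs + f y       ≤⟨ Linked-length≤ f increasing bounded linked ⟩
    D                     ∎
    where open ≤-Reasoning

  [a⊔b]⊔c≤a⊔d : ∀ a {b c d} → b ≤ d → c ≤ d → (a ⊔ b) ⊔ c ≤ a ⊔ d
  [a⊔b]⊔c≤a⊔d a b≤d c≤d = ⊔-lub (⊔-lub (m≤m⊔n a _) (≤-trans b≤d (m≤n⊔m a _))) (≤-trans c≤d (m≤n⊔m a _))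

  Unique-lookup-≢ : ∀ {A : Set} (xs : List A) → Unique xs → ∀ i j → toℕ i < toℕ j → List.lookup xs i ≢ List.lookup xs j
  Unique-lookup-≢ (x ∷ xs) (x∉xs ∷ _) zero (suc j) _ = All.lookup x∉xs (∈-lookup j)
  Unique-lookup-≢ (x ∷ xs) (_ ∷ unique) (suc i) (suc j) (s≤s i<j) = Unique-lookup-≢ xs unique i j i<j

  Unique⇒length≤ : ∀ {N} (xs : List (Fin N)) → Unique xs → length xs ≤ N
  Unique⇒length≤ {N} xs unique with length xs ≤? N
  ... | yes fits = fits
  ... | no overflows with Fin.pigeonhole (≰⇒> overflows) (List.lookup xs)
  ...   | i , j , i<j , same = contradiction same (Unique-lookup-≢ xs unique i j i<j)

  module _ {n : ℕ} where

    target : Gate n → Fin n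
    target (X q) = q
    target (CNOT _ t _) = t
    target (Toffoli _ _ t _ _ _) = t

    -- Every gate flips its target by a function of its controls.
    control : Gate n → Vec Bool n → Bool
    control (X _) s = true
    control (CNOT c _ _) s = lookup s c
    control (Toffoli c₁ c₂ _ _ _ _) s = lookup s c₁ ∧ lookup s c₂

    target∈qubits : ∀ g → target g ∈ qubits g
    target∈qubits (X _) = here refl
    target∈qubits (CNOT _ _ _) = there (here refl)
    target∈qubits (Toffoli _ _ _ _ _ _) = there (there (here refl))

    applyGate-target : ∀ g s → lookup (applyGate g s) (target g) ≡ lookup s (target g) xor control g s
    applyGate-target (X q) s = trans (Vec.lookup∘updateAt q s) (not≡xor-true (lookup s q))
    applyGate-target (CNOT _ t _) s = Vec.lookup∘updateAt t s
    applyGate-target (Toffoli _ _ t _ _ _) s = Vec.lookup∘updateAt t s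

    applyGate-≢target : ∀ g s {w} → w ≢ target g → lookup (applyGate g s) w ≡ lookup s w
    applyGate-≢target (X q) s {w} w≢q = Vec.lookup∘updateAt′ w q w≢q s
    applyGate-≢target (CNOT _ t _) s {w} w≢t = Vec.lookup∘updateAt′ w t w≢t s
    applyGate-≢target (Toffoli _ _ t _ _ _) s {w} w≢t = Vec.lookup∘updateAt′ w t w≢t s

    control-applyGate : ∀ g s → control g (applyGate g s) ≡ control g s
    control-applyGate (X _) s = refl
    control-applyGate g@(CNOT c _ c≢t) s = applyGate-≢target g s c≢t
    control-applyGate g@(Toffoli c₁ c₂ _ _ c₁≢t c₂≢t) s =
      cong₂ _∧_ (applyGate-≢target g s c₁≢t) (applyGate-≢target g s c₂≢t)

    applyGate-involutive : ∀ g s → applyGate g (applyGate g s) ≡ s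
    applyGate-involutive g s = vec-ext _ _ pointwise
      where
      pointwise : ∀ w → lookup (applyGate g (applyGate g s)) w ≡ lookup s w
      pointwise w with w Fin.≟ target g
      ... | no w≢t = trans (applyGate-≢target g _ w≢t) (applyGate-≢target g s w≢t)
      ... | yes refl = begin
        lookup (applyGate g (applyGate g s)) w               ≡⟨ applyGate-target g _ ⟩
        lookup (applyGate g s) w xor control g (applyGate g s) ≡⟨ cong₂ _xor_ (applyGate-target g s) (control-applyGate g s) ⟩
        (lookup s w xor control g s) xor control g s          ≡⟨ xor-cancelʳ _ _ ⟩
        lookup s w                                            ∎
        where open ≡-Reasoning

    Agree : Vec Bool n → Vec Bool n → Fin n → Set
    Agree s s' v = lookup s v ≡ lookup s' v

    controls : Gate n → List (Fin n)
    controls (X _) = []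
    controls (CNOT c _ _) = c ∷ []
    controls (Toffoli c₁ c₂ _ _ _ _) = c₁ ∷ c₂ ∷ []

    All-qubits⇒All-controls : ∀ {P : Fin n → Set} g → All P (qubits g) → All P (controls g)
    All-qubits⇒All-controls (X _) _ = []
    All-qubits⇒All-controls (CNOT _ _ _) (c ∷ _) = c ∷ []
    All-qubits⇒All-controls (Toffoli _ _ _ _ _ _) (c₁ ∷ c₂ ∷ _) = c₁ ∷ c₂ ∷ []

    control-local : ∀ g {s s'} → All (Agree s s') (controls g) → control g s ≡ control g s'
    control-local (X _) _ = refl
    control-local (CNOT _ _ _) (c ∷ _) = c
    control-local (Toffoli _ _ _ _ _ _) (c₁ ∷ c₂ ∷ _) = cong₂ _∧_ c₁ c₂

    applyGate-local : ∀ g {s s'} → All (Agree s s') (controls g) →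
                      Agree s s' ⊆ Agree (applyGate g s) (applyGate g s')
    applyGate-local g {s} {s'} agree {w} eq with w Fin.≟ target g
    ... | no w≢t = trans (applyGate-≢target g s w≢t) (trans eq (sym (applyGate-≢target g s' w≢t)))
    ... | yes refl = trans (applyGate-target g s)
      (trans (cong₂ _xor_ eq (control-local g agree)) (sym (applyGate-target g s')))

    run-++ : ∀ (c₁ c₂ : Circuit n) s → run (c₁ ++ c₂) s ≡ run c₂ (run c₁ s)
    run-++ [] c₂ s = refl
    run-++ (g ∷ c₁) c₂ s = run-++ c₁ c₂ (applyGate g s)

    run-reverse : ∀ (c : Circuit n) s → run (reverse c) (run c s) ≡ s
    run-reverse [] s = refl
    run-reverse (g ∷ c) s = begin
      run (reverse (g ∷ c)) (run c (applyGate g s))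
        ≡⟨ cong (λ c′ → run c′ (run c (applyGate g s))) (List.unfold-reverse g c) ⟩
      run (reverse c ++ g ∷ []) (run c (applyGate g s))
        ≡⟨ run-++ (reverse c) (g ∷ []) _ ⟩
      applyGate g (run (reverse c) (run c (applyGate g s)))
        ≡⟨ cong (applyGate g) (run-reverse c (applyGate g s)) ⟩
      applyGate g (applyGate g s)
        ≡⟨ applyGate-involutive g s ⟩
      s ∎
      where open ≡-Reasoning

    ActsWithin : (Fin n → Set) → Circuit n → Set
    ActsWithin P = All (All P ∘ qubits)

    ActsWithin-reverse : ∀ {P} {c : Circuit n} → ActsWithin P c → ActsWithin P (reverse c)
    ActsWithin-reverse within = All.tabulate (All.lookup within ∘ Any.reverse⁻)

    ActsWithin-map : ∀ {P Q} {c : Circuit n} → P ⊆ Q → ActsWithin P c → ActsWithin Q c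
    ActsWithin-map P⊆Q = All.map (All.map P⊆Q)

    ActsWithin-zipWith : ∀ {P Q R} {c : Circuit n} → (∀ {v} → P v → Q v → R v) →
                         ActsWithin P c → ActsWithin Q c → ActsWithin R c
    ActsWithin-zipWith f p q = All.zipWith (All.zipWith λ (pv , qv) → f pv qv) (p , q)

    run-frame : ∀ (c : Circuit n) s {w} → All ((w ≢_) ∘ target) c → lookup (run c s) w ≡ lookup s w
    run-frame [] s _ = refl
    run-frame (g ∷ c) s (w≢t ∷ rest) = trans (run-frame c _ rest) (applyGate-≢target g s w≢t)

    run-untouched : ∀ (c : Circuit n) s {w} → ActsWithin (w ≢_) c → lookup (run c s) w ≡ lookup s w
    run-untouched c s untouched = run-frame c s (All.map (λ {g} w∉g → All.lookup w∉g (target∈qubits g)) untouched)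

    run-outside : ∀ (c : Circuit n) s {P w} → ActsWithin P c → (∀ {v} → P v → v ≢ w) → lookup (run c s) w ≡ lookup s w
    run-outside c s within P≢w = run-untouched c s (ActsWithin-map (λ Pv → P≢w Pv ∘ sym) within)

    run-local : ∀ (c : Circuit n) {s s'} → ActsWithin (Agree s s') c →
                Agree s s' ⊆ Agree (run c s) (run c s')
    run-local [] _ eq = eq
    run-local (g ∷ c) (agree-g ∷ agree-c) =
      run-local c (ActsWithin-map (applyGate-local g agree-ctl) agree-c) ∘ applyGate-local g agree-ctl
      where agree-ctl = All-qubits⇒All-controls g agree-g

    accumulated : Circuit n → Vec Bool n → Bool
    accumulated c s = parity (List.map (λ g → control g s) c)

    accumulated-local : ∀ (c : Circuit n) {s s'} → All (All (Agree s s') ∘ controls) c →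
                        accumulated c s ≡ accumulated c s'
    accumulated-local [] _ = refl
    accumulated-local (g ∷ c) (agree-g ∷ agree-c) = cong₂ _xor_ (control-local g agree-g) (accumulated-local c agree-c)

    AccumulatesInto : Fin n → Circuit n → Set
    AccumulatesInto t = All (λ g → target g ≡ t × All (_≢ t) (controls g))

    run-accumulate : ∀ {t} (c : Circuit n) s → AccumulatesInto t c →
                     lookup (run c s) t ≡ lookup s t xor accumulated c s
    run-accumulate [] s [] = sym (xor-identityʳ _)
    run-accumulate {t} (g ∷ c) s ((refl , _) ∷ rest) = begin
      lookup (run c s′) t                                 ≡⟨ run-accumulate c s′ rest ⟩
      lookup s′ t xor accumulated c s′                    ≡⟨ cong₂ _xor_ (applyGate-target g s) (accumulated-local c unchanged) ⟩
      (lookup s t xor control g s) xor accumulated c s     ≡⟨ xor-assoc (lookup s t) _ _ ⟩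
      lookup s t xor (control g s xor accumulated c s)     ∎
      where
      open ≡-Reasoning
      s′ = applyGate g s
      unchanged : All (All (Agree s′ s) ∘ controls) c
      unchanged = All.map (All.map (applyGate-≢target g s) ∘ proj₂) rest

    AccumulatesInto-frame : ∀ {t w} {c : Circuit n} → w ≢ t → AccumulatesInto t c → All ((w ≢_) ∘ target) c
    AccumulatesInto-frame w≢t = All.map λ (target≡t , _) w≡target → w≢t (trans w≡target target≡t)

    record TwoBlockSpec (cₛ cₜ : Circuit n) (s t : Fin n) (S : Vec Bool n) : Set where
      field
        at-s : lookup (run cₜ (run cₛ S)) s ≡ lookup S s xor accumulated cₛ S
        at-t : lookup (run cₜ (run cₛ S)) t ≡ lookup S t xor accumulated cₜ S
        elsewhere : ∀ {w} → w ≢ s → w ≢ t → lookup (run cₜ (run cₛ S)) w ≡ lookup S w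

    run-two-blocks : ∀ {s t} (cₛ cₜ : Circuit n) S → t ≢ s → AccumulatesInto s cₛ → AccumulatesInto t cₜ →
                     All (All (_≢ s) ∘ controls) cₜ → TwoBlockSpec cₛ cₜ s t S
    run-two-blocks {s} {t} cₛ cₜ S t≢s into-s into-t cₜ-avoids-s = record
      { at-s = trans (run-frame cₜ Sₛ (AccumulatesInto-frame (t≢s ∘ sym) into-t)) (run-accumulate cₛ S into-s)
      ; at-t = begin
          lookup (run cₜ Sₛ) t
            ≡⟨ run-accumulate cₜ Sₛ into-t ⟩
          lookup Sₛ t xor accumulated cₜ Sₛ
            ≡⟨ cong₂ _xor_ (afterₛ t≢s) (accumulated-local cₜ (All.map (All.map afterₛ) cₜ-avoids-s)) ⟩
          lookup S t xor accumulated cₜ S ∎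
      ; elsewhere = λ w≢s w≢t → trans (run-frame cₜ Sₛ (AccumulatesInto-frame w≢t into-t)) (afterₛ w≢s) }
      where
      open ≡-Reasoning
      Sₛ = run cₛ S
      afterₛ : ∀ {w} → w ≢ s → lookup Sₛ w ≡ lookup S w
      afterₛ w≢s = run-frame cₛ S (AccumulatesInto-frame w≢s into-s)

    level : Gate n → (Fin n → ℕ) → ℕ
    level g ℓ = suc (max 0 (List.map ℓ (qubits g)))

    level-above : ∀ g ℓ {q} → q ∈ qubits g → ℓ q < level g ℓ
    level-above g ℓ q∈g = s≤s (All.lookup (xs≤max 0 (List.map ℓ (qubits g))) (∈-map⁺ ℓ q∈g))

    level-bounded : ∀ g ℓ {D} → All (λ q → ℓ q ≤ D) (qubits g) → level g ℓ ≤ suc D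
    level-bounded g ℓ bounded = s≤s (max≤v⁺ z≤n (All.map⁺ bounded))

    open DecMembership (Fin._≟_ {n}) using (_∈?_)

    relevel : Gate n → (Fin n → ℕ) → Fin n → ℕ
    relevel g ℓ w with w ∈? qubits g
    ... | yes _ = level g ℓ
    ... | no _ = ℓ w

    levels : Circuit n → (Fin n → ℕ) → Fin n → ℕ
    levels [] ℓ = ℓ
    levels (g ∷ c) ℓ = levels c (relevel g ℓ)

    gateLevel : ∀ (c : Circuit n) → (Fin n → ℕ) → Fin (length c) → ℕ
    gateLevel (g ∷ c) ℓ zero = level g ℓ
    gateLevel (g ∷ c) ℓ (suc i) = gateLevel c (relevel g ℓ) i

    relevel-∈ : ∀ g ℓ {w} → w ∈ qubits g → relevel g ℓ w ≡ level g ℓ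
    relevel-∈ g ℓ {w} w∈g with w ∈? qubits g
    ... | yes _ = refl
    ... | no w∉g = contradiction w∈g w∉g

    relevel-∉ : ∀ g ℓ {w} → w ∉ qubits g → relevel g ℓ w ≡ ℓ w
    relevel-∉ g ℓ {w} w∉g with w ∈? qubits g
    ... | yes w∈g = contradiction w∈g w∉g
    ... | no _ = refl

    relevel-≥ : ∀ g ℓ w → ℓ w ≤ relevel g ℓ w
    relevel-≥ g ℓ w with w ∈? qubits g
    ... | yes w∈g = <⇒≤ (level-above g ℓ w∈g)
    ... | no _ = ≤-refl

    levels-≥ : ∀ (c : Circuit n) ℓ w → ℓ w ≤ levels c ℓ w
    levels-≥ [] ℓ w = ≤-refl
    levels-≥ (g ∷ c) ℓ w = ≤-trans (relevel-≥ g ℓ w) (levels-≥ c (relevel g ℓ) w)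

    gateLevel≤levels : ∀ (c : Circuit n) ℓ i {q} → q ∈ qubits (gateAt c i) → gateLevel c ℓ i ≤ levels c ℓ q
    gateLevel≤levels (g ∷ c) ℓ zero {q} q∈g =
      subst (_≤ levels c (relevel g ℓ) q) (relevel-∈ g ℓ q∈g) (levels-≥ c (relevel g ℓ) q)
    gateLevel≤levels (g ∷ c) ℓ (suc i) q∈g = gateLevel≤levels c (relevel g ℓ) i q∈g

    gateLevel-first-use : ∀ (c : Circuit n) ℓ j {q} → q ∈ qubits (gateAt c j) →
      (∀ (l : Fin (length c)) → toℕ l < toℕ j → q ∉ qubits (gateAt c l)) → ℓ q < gateLevel c ℓ j
    gateLevel-first-use (g ∷ c) ℓ zero q∈g _ = level-above g ℓ q∈g
    gateLevel-first-use (g ∷ c) ℓ (suc j) {q} q∈j unused =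
      subst (_< gateLevel c (relevel g ℓ) j) (relevel-∉ g ℓ (unused zero (s≤s z≤n)))
        (gateLevel-first-use c (relevel g ℓ) j q∈j (λ l l<j → unused (suc l) (s≤s l<j)))

    gateLevel-Edge : ∀ (c : Circuit n) ℓ {i j} → Edge c i j → gateLevel c ℓ i < gateLevel c ℓ j
    gateLevel-Edge (g ∷ c) ℓ {_} {zero} (_ , _ , _ , () , _)
    gateLevel-Edge (g ∷ c) ℓ {zero} {suc j} (q , q∈g , q∈j , _ , between) =
      subst (_< gateLevel c (relevel g ℓ) j) (relevel-∈ g ℓ q∈g)
        (gateLevel-first-use c (relevel g ℓ) j q∈j (λ l l<j → between (suc l) (s≤s z≤n) (s≤s l<j)))
    gateLevel-Edge (g ∷ c) ℓ {suc i} {suc j} (q , q∈i , q∈j , s≤s i<j , between) =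
      gateLevel-Edge c (relevel g ℓ) (q , q∈i , q∈j , i<j , λ l i<l l<j → between (suc l) (s≤s i<l) (s≤s l<j))

    gateLevel-positive : ∀ (c : Circuit n) ℓ i → 1 ≤ gateLevel c ℓ i
    gateLevel-positive (g ∷ c) ℓ zero = s≤s z≤n
    gateLevel-positive (g ∷ c) ℓ (suc i) = gateLevel-positive c (relevel g ℓ) i

    DepthAtMost-levels : ∀ (c : Circuit n) d → (∀ w → levels c (λ _ → 0) w ≤ d) → DepthAtMost c d
    DepthAtMost-levels c d bounded [] _ = z≤n
    DepthAtMost-levels c d bounded (i ∷ path) linked = begin
      suc (length path)            ≡⟨ +-comm 1 (length path) ⟩
      length path + 1              ≤⟨ +-monoʳ-≤ (length path) (gateLevel-positive c ℓ₀ i) ⟩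
      length path + gateLevel c ℓ₀ i ≤⟨ Linked-length≤ (gateLevel c ℓ₀) (gateLevel-Edge c ℓ₀) gateBounded linked ⟩
      d                            ∎
      where
      open ≤-Reasoning
      ℓ₀ = λ _ → 0
      gateBounded : ∀ j → gateLevel c ℓ₀ j ≤ d
      gateBounded j = ≤-trans (gateLevel≤levels c ℓ₀ j (target∈qubits (gateAt c j))) (bounded _)

    levels-++ : ∀ (c₁ c₂ : Circuit n) ℓ → levels (c₁ ++ c₂) ℓ ≡ levels c₂ (levels c₁ ℓ)
    levels-++ [] c₂ ℓ = refl
    levels-++ (g ∷ c₁) c₂ ℓ = levels-++ c₁ c₂ (relevel g ℓ)

    levels-frame : ∀ (c : Circuit n) ℓ {w} → ActsWithin (w ≢_) c → levels c ℓ w ≡ ℓ w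
    levels-frame [] ℓ _ = refl
    levels-frame (g ∷ c) ℓ (w∉g ∷ w∉c) =
      trans (levels-frame c (relevel g ℓ) w∉c) (relevel-∉ g ℓ (All.All¬⇒¬Any w∉g))

    -- Relative to the wires c touches only, so that circuits on disjoint wires compose in parallel.
    LevelBound : Circuit n → ℕ → Set
    LevelBound c d = ∀ ℓ D → ActsWithin (λ v → ℓ v ≤ D) c → ∀ w → levels c ℓ w ≤ ℓ w ⊔ (D + d)

    LevelBound-gate : ∀ g → LevelBound (g ∷ []) 1
    LevelBound-gate g ℓ D (bounded ∷ []) w with w ∈? qubits g
    ... | yes _ = ≤-trans (level-bounded g ℓ bounded) (≤-trans (≤-reflexive (+-comm 1 D)) (m≤n⊔m (ℓ w) _))
    ... | no _ = m≤m⊔n (ℓ w) _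

    LevelBound-++ : ∀ {c₁ c₂ d₁ d₂} → LevelBound c₁ d₁ → LevelBound c₂ d₂ → LevelBound (c₁ ++ c₂) (d₁ + d₂)
    LevelBound-++ {c₁} {c₂} {d₁} {d₂} bound₁ bound₂ ℓ D within w rewrite levels-++ c₁ c₂ ℓ = begin
      levels c₂ ℓ₁ w                  ≤⟨ bound₂ ℓ₁ (D + d₁) within₂′ w ⟩
      ℓ₁ w ⊔ (D + d₁ + d₂)            ≤⟨ ⊔-monoˡ-≤ _ (bound₁ ℓ D within₁ w) ⟩
      (ℓ w ⊔ (D + d₁)) ⊔ (D + d₁ + d₂)
        ≤⟨ [a⊔b]⊔c≤a⊔d (ℓ w) (+-monoʳ-≤ D (m≤m+n d₁ d₂)) (≤-reflexive (+-assoc D d₁ d₂)) ⟩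
      ℓ w ⊔ (D + (d₁ + d₂))           ∎
      where
      open ≤-Reasoning
      ℓ₁ = levels c₁ ℓ
      within₁ = All.++⁻ˡ c₁ within
      within₂′ : ActsWithin (λ v → ℓ₁ v ≤ D + d₁) c₂
      within₂′ = ActsWithin-map
        (λ {v} ℓv≤D → ≤-trans (bound₁ ℓ D within₁ v) (⊔-lub (≤-trans ℓv≤D (m≤m+n D d₁)) ≤-refl))
        (All.++⁻ʳ c₁ within)

    LevelBound-length : ∀ c → LevelBound c (length c)
    LevelBound-length [] ℓ D _ w = subst (ℓ w ≤_) (cong (ℓ w ⊔_) (sym (+-identityʳ D))) (m≤m⊔n (ℓ w) D)
    LevelBound-length (g ∷ c) = LevelBound-++ {g ∷ []} (LevelBound-gate g) (LevelBound-length c)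

    LevelBound-parallel : ∀ {P Q} {c₁ c₂ d₁ d₂} → (∀ {v} → P v → ¬ Q v) →
      ActsWithin P c₁ → ActsWithin Q c₂ → LevelBound c₁ d₁ → LevelBound c₂ d₂ → LevelBound (c₁ ++ c₂) (d₁ ⊔ d₂)
    LevelBound-parallel {P} {Q} {c₁} {c₂} {d₁} {d₂} disjoint P-c₁ Q-c₂ bound₁ bound₂ ℓ D within w
      rewrite levels-++ c₁ c₂ ℓ = begin
        levels c₂ ℓ₁ w                    ≤⟨ bound₂ ℓ₁ D within₂′ w ⟩
        ℓ₁ w ⊔ (D + d₂)                   ≤⟨ ⊔-monoˡ-≤ _ (bound₁ ℓ D (All.++⁻ˡ c₁ within) w) ⟩
        (ℓ w ⊔ (D + d₁)) ⊔ (D + d₂)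
          ≤⟨ [a⊔b]⊔c≤a⊔d (ℓ w) (+-monoʳ-≤ D (m≤m⊔n d₁ d₂)) (+-monoʳ-≤ D (m≤n⊔m d₁ d₂)) ⟩
        ℓ w ⊔ (D + (d₁ ⊔ d₂))             ∎
      where
      open ≤-Reasoning
      ℓ₁ = levels c₁ ℓ
      untouched : ∀ {v} → Q v → ActsWithin (v ≢_) c₁
      untouched Qv = ActsWithin-map (λ Pu v≡u → disjoint Pu (subst Q v≡u Qv)) P-c₁
      within₂′ : ActsWithin (λ v → ℓ₁ v ≤ D) c₂
      within₂′ = ActsWithin-zipWith (λ Qv ℓv≤D → ≤-trans (≤-reflexive (levels-frame c₁ ℓ (untouched Qv))) ℓv≤D)
                   Q-c₂ (All.++⁻ʳ c₁ within)

    LevelBound⇒DepthAtMost : ∀ {c d} → LevelBound c d → DepthAtMost c d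
    LevelBound⇒DepthAtMost {c} {d} bound =
      DepthAtMost-levels c d (bound (λ _ → 0) 0 (All.universal (λ _ → All.universal (λ _ → z≤n) _) c))

    WidthAtMost-complexity : ∀ (c : Circuit n) {w} → complexity c ≤ w → WidthAtMost c w
    WidthAtMost-complexity c c≤w S (unique , _) = ≤-trans (Unique⇒length≤ S unique) c≤w

  bitValue : Bool → ℕ
  bitValue b = if b then 1 else 0

  lsb : ℕ → Bool
  lsb x = x % 2 ≡ᵇ 1

  bitsLE : (k : ℕ) → ℕ → Vec Bool k
  bitsLE zero x = []
  bitsLE (suc k) x = lsb x ∷ bitsLE k (x / 2)

  lookup-toBits : ∀ k x (j : Fin k) → lookup (toBits k x) (Fin.opposite j) ≡ lookup (bitsLE k x) j
  lookup-toBits (suc k) x zero = lookup-∷ʳ-last (toBits k (x / 2)) _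
    where
    lookup-∷ʳ-last : ∀ {A : Set} {k} (xs : Vec A k) y → lookup (xs ∷ʳ y) (Fin.fromℕ k) ≡ y
    lookup-∷ʳ-last [] y = refl
    lookup-∷ʳ-last (x ∷ xs) y = lookup-∷ʳ-last xs y
  lookup-toBits (suc k) x (suc j) =
    trans (lookup-∷ʳ-inject₁ (toBits k (x / 2)) _ (Fin.opposite j)) (lookup-toBits k (x / 2) j)
    where
    lookup-∷ʳ-inject₁ : ∀ {A : Set} {k} (xs : Vec A k) y i → lookup (xs ∷ʳ y) (Fin.inject₁ i) ≡ lookup xs i
    lookup-∷ʳ-inject₁ (x ∷ xs) y zero = refl
    lookup-∷ʳ-inject₁ (x ∷ xs) y (suc i) = lookup-∷ʳ-inject₁ xs y i

  bitValue<2 : ∀ b → bitValue b < 2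
  bitValue<2 false = s≤s z≤n
  bitValue<2 true = s≤s (s≤s z≤n)

  lsb-bitValue : ∀ b → lsb (bitValue b) ≡ b
  lsb-bitValue false = refl
  lsb-bitValue true = refl

  lsb+/2 : ∀ x → x ≡ bitValue (lsb x) + x / 2 * 2
  lsb+/2 x = trans (m≡m%n+[m/n]*n x 2) (cong (_+ x / 2 * 2) (remainder (x % 2) (m%n<n x 2)))
    where
    remainder : ∀ r → r < 2 → r ≡ bitValue (r ≡ᵇ 1)
    remainder 0 _ = refl
    remainder 1 _ = refl
    remainder (suc (suc r)) (s≤s (s≤s ()))

  lsb-bitValue+*2 : ∀ b q → lsb (bitValue b + q * 2) ≡ b
  lsb-bitValue+*2 b q = trans (cong (_≡ᵇ 1) ([m+kn]%n≡m%n (bitValue b) q 2)) (lsb-bitValue b)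

  bitValue+*2/2 : ∀ b q → (bitValue b + q * 2) / 2 ≡ q
  bitValue+*2/2 b q = begin
    (bitValue b + q * 2) / 2    ≡⟨ +-distrib-/-∣ʳ (bitValue b) (n∣m*n q) ⟩
    bitValue b / 2 + q * 2 / 2  ≡⟨ cong₂ _+_ (m<n⇒m/n≡0 (bitValue<2 b)) (m*n/n≡m q 2) ⟩
    q                           ∎
    where open ≡-Reasoning

  bitsLE-+ : ∀ k x y c {s m} → bitValue (lsb x) + bitValue (lsb y) + c ≡ bitValue s + bitValue m * 2 →
             bitsLE (suc k) (x + y + c) ≡ s ∷ bitsLE k (x / 2 + y / 2 + bitValue m)
  bitsLE-+ k x y c {s} {m} adder = trans (cong (λ z → lsb z ∷ bitsLE k (z / 2)) split)
    (cong₂ (λ b z → b ∷ bitsLE k z) (lsb-bitValue+*2 s q) (bitValue+*2/2 s q))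
    where
    q = x / 2 + y / 2 + bitValue m
    split : x + y + c ≡ bitValue s + q * 2
    split = begin
      x + y + c                                                         ≡⟨ cong₂ (λ u v → u + v + c) (lsb+/2 x) (lsb+/2 y) ⟩
      (bitValue (lsb x) + x / 2 * 2) + (bitValue (lsb y) + y / 2 * 2) + c ≡⟨ regroup (bitValue (lsb x)) (bitValue (lsb y)) c (x / 2) (y / 2) ⟩
      (bitValue (lsb x) + bitValue (lsb y) + c) + (x / 2 + y / 2) * 2   ≡⟨ cong (_+ (x / 2 + y / 2) * 2) adder ⟩
      (bitValue s + bitValue m * 2) + (x / 2 + y / 2) * 2               ≡⟨ regroup′ (bitValue s) (bitValue m) (x / 2) (y / 2) ⟩
      bitValue s + (x / 2 + y / 2 + bitValue m) * 2                     ∎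
      where
      open ≡-Reasoning
      regroup : ∀ a b c p q → (a + p * 2) + (b + q * 2) + c ≡ (a + b + c) + (p + q) * 2
      regroup = solve-∀
      regroup′ : ∀ s m p q → (s + m * 2) + (p + q) * 2 ≡ s + (p + q + m) * 2
      regroup′ = solve-∀

  /2-< : ∀ k {x} → x < 2 ^ suc k → x / 2 < 2 ^ k
  /2-< k {x} x< = m<n*o⇒m/o<n {x} {2 ^ k} {2} (subst (x <_) (*-comm 2 (2 ^ k)) x<)

  halfAdder-bits : ∀ a b → bitValue a + bitValue b + 0 ≡ bitValue (parity (a ∷ b ∷ [])) + bitValue (parity (a ∧ b ∷ [])) * 2
  halfAdder-bits false false = refl
  halfAdder-bits false true = refl
  halfAdder-bits true false = refl
  halfAdder-bits true true = refl

  -- the carry is the majority of the three bits, i.e. the parity of their pairwise products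
  fullAdder-bits : ∀ a b c → bitValue a + bitValue b + bitValue c ≡
                   bitValue (parity (a ∷ b ∷ c ∷ [])) + bitValue (parity (a ∧ b ∷ a ∧ c ∷ b ∧ c ∷ [])) * 2
  fullAdder-bits false false false = refl
  fullAdder-bits false false true = refl
  fullAdder-bits false true false = refl
  fullAdder-bits false true true = refl
  fullAdder-bits true false false = refl
  fullAdder-bits true false true = refl
  fullAdder-bits true true false = refl
  fullAdder-bits true true true = refl

  record AdderLayout (n k : ℕ) : Set where
    field
      a b s c : Fin k → Fin n
      a≢b : ∀ i j → a i ≢ b j
      a≢s : ∀ i j → a i ≢ s j
      a≢c : ∀ i j → a i ≢ c j
      b≢s : ∀ i j → b i ≢ s j
      b≢c : ∀ i j → b i ≢ c j
      s≢c : ∀ i j → s i ≢ c j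
      s-injective : ∀ {i j} → s i ≡ s j → i ≡ j
      c-injective : ∀ {i j} → c i ≡ c j → i ≡ j
  open AdderLayout

  record CarryIn {n k} (W : AdderLayout n k) (cin : Fin n) : Set where
    field
      cin≢a : ∀ j → cin ≢ a W j
      cin≢b : ∀ j → cin ≢ b W j
      cin≢s : ∀ j → cin ≢ s W j
      cin≢c : ∀ j → cin ≢ c W j
  open CarryIn

  AdderWithin : ∀ {n k} → (Fin n → Set) → AdderLayout n k → Set
  AdderWithin P W = ∀ i → P (a W i) × P (b W i) × P (s W i) × P (c W i)

  module _ {n k : ℕ} (W : AdderLayout n (suc k)) where

    tail : AdderLayout n k
    tail = record
      { a = a W ∘ suc ; b = b W ∘ suc ; s = s W ∘ suc ; c = c W ∘ suc
      ; a≢b = λ i j → a≢b W (suc i) (suc j) ; a≢s = λ i j → a≢s W (suc i) (suc j)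
      ; a≢c = λ i j → a≢c W (suc i) (suc j) ; b≢s = λ i j → b≢s W (suc i) (suc j)
      ; b≢c = λ i j → b≢c W (suc i) (suc j) ; s≢c = λ i j → s≢c W (suc i) (suc j)
      ; s-injective = Fin.suc-injective ∘ s-injective W
      ; c-injective = Fin.suc-injective ∘ c-injective W }

    carryIn-tail : CarryIn tail (c W zero)
    carryIn-tail = record
      { cin≢a = λ j → a≢c W (suc j) zero ∘ sym
      ; cin≢b = λ j → b≢c W (suc j) zero ∘ sym
      ; cin≢s = λ j → s≢c W (suc j) zero ∘ sym
      ; cin≢c = λ j → Fin.0≢1+n ∘ c-injective W }

    private
      a₀ = a W zero
      b₀ = b W zero
      s₀ = s W zero
      c₀ = c W zero
      a₀≢b₀ = a≢b W zero zero
      a₀≢s₀ = a≢s W zero zero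
      a₀≢c₀ = a≢c W zero zero
      b₀≢s₀ = b≢s W zero zero
      b₀≢c₀ = b≢c W zero zero
      c₀≢s₀ = s≢c W zero zero ∘ sym

    halfAdderSum halfAdderCarry : Circuit n
    halfAdderSum = CNOT a₀ s₀ a₀≢s₀ ∷ CNOT b₀ s₀ b₀≢s₀ ∷ []
    halfAdderCarry = Toffoli a₀ b₀ c₀ a₀≢b₀ a₀≢c₀ b₀≢c₀ ∷ []

    halfAdder-spec : ∀ S → TwoBlockSpec halfAdderSum halfAdderCarry s₀ c₀ S
    halfAdder-spec S = run-two-blocks halfAdderSum halfAdderCarry S c₀≢s₀
      ((refl , a₀≢s₀ ∷ []) ∷ (refl , b₀≢s₀ ∷ []) ∷ [])
      ((refl , a₀≢c₀ ∷ b₀≢c₀ ∷ []) ∷ [])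
      ((a₀≢s₀ ∷ b₀≢s₀ ∷ []) ∷ [])

    module _ (cin : Fin n) (p : CarryIn W cin) where

      private
        cin≢a₀ = cin≢a p zero
        cin≢b₀ = cin≢b p zero
        cin≢s₀ = cin≢s p zero
        cin≢c₀ = cin≢c p zero

      fullAdderSum fullAdderCarry : Circuit n
      fullAdderSum = CNOT a₀ s₀ a₀≢s₀ ∷ CNOT b₀ s₀ b₀≢s₀ ∷ CNOT cin s₀ cin≢s₀ ∷ []
      fullAdderCarry =
        Toffoli a₀ b₀ c₀ a₀≢b₀ a₀≢c₀ b₀≢c₀ ∷
        Toffoli a₀ cin c₀ (cin≢a₀ ∘ sym) a₀≢c₀ cin≢c₀ ∷
        Toffoli b₀ cin c₀ (cin≢b₀ ∘ sym) b₀≢c₀ cin≢c₀ ∷ []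

      fullAdder-spec : ∀ S → TwoBlockSpec fullAdderSum fullAdderCarry s₀ c₀ S
      fullAdder-spec S = run-two-blocks fullAdderSum fullAdderCarry S c₀≢s₀
        ((refl , a₀≢s₀ ∷ []) ∷ (refl , b₀≢s₀ ∷ []) ∷ (refl , cin≢s₀ ∷ []) ∷ [])
        ((refl , a₀≢c₀ ∷ b₀≢c₀ ∷ []) ∷ (refl , a₀≢c₀ ∷ cin≢c₀ ∷ []) ∷
         (refl , b₀≢c₀ ∷ cin≢c₀ ∷ []) ∷ [])
        ((a₀≢s₀ ∷ b₀≢s₀ ∷ []) ∷ (a₀≢s₀ ∷ cin≢s₀ ∷ []) ∷ (b₀≢s₀ ∷ cin≢s₀ ∷ []) ∷ [])

  ripple : ∀ {n} k (W : AdderLayout n k) cin → CarryIn W cin → Circuit n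
  ripple zero W cin p = []
  ripple (suc k) W cin p = (fullAdderSum W cin p ++ fullAdderCarry W cin p) ++ ripple k (tail W) (c W zero) (carryIn-tail W)

  adder : ∀ {n} k → AdderLayout n (suc k) → Circuit n
  adder k W = (halfAdderSum W ++ halfAdderCarry W) ++ ripple k (tail W) (c W zero) (carryIn-tail W)

  rippleOut : ∀ {n} k → AdderLayout n k → Fin n → Fin (suc k) → Fin n
  adderOut : ∀ {n} k → AdderLayout n (suc k) → Fin (suc (suc k)) → Fin n

  rippleOut zero W cin zero = cin
  rippleOut (suc k) W cin = adderOut k W

  adderOut k W zero = s W zero
  adderOut k W (suc j) = rippleOut k (tail W) (c W zero) j

  module _ {n : ℕ} where

    Reads : ∀ {k} → Vec Bool n → (Fin k → Fin n) → Vec Bool k → Set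
    Reads S r v = ∀ i → lookup S (r i) ≡ lookup v i

    Zeroed : ∀ {k} → Vec Bool n → (Fin k → Fin n) → Set
    Zeroed S r = ∀ i → lookup S (r i) ≡ false

    ripple-within : ∀ {P : Fin n → Set} k (W : AdderLayout n k) cin p → AdderWithin P W → P cin → ActsWithin P (ripple k W cin p)
    ripple-within zero W cin p _ _ = []
    ripple-within (suc k) W cin p within P-cin with within zero
    ... | P-a , P-b , P-s , P-c = All.++⁺
      ((P-a ∷ P-s ∷ []) ∷ (P-b ∷ P-s ∷ []) ∷ (P-cin ∷ P-s ∷ []) ∷
       (P-a ∷ P-b ∷ P-c ∷ []) ∷ (P-a ∷ P-cin ∷ P-c ∷ []) ∷ (P-b ∷ P-cin ∷ P-c ∷ []) ∷ [])
      (ripple-within k (tail W) (c W zero) (carryIn-tail W) (within ∘ suc) P-c)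

    adder-within : ∀ {P : Fin n → Set} k (W : AdderLayout n (suc k)) → AdderWithin P W → ActsWithin P (adder k W)
    adder-within k W within with within zero
    ... | P-a , P-b , P-s , P-c = All.++⁺
      ((P-a ∷ P-s ∷ []) ∷ (P-b ∷ P-s ∷ []) ∷ (P-a ∷ P-b ∷ P-c ∷ []) ∷ [])
      (ripple-within k (tail W) (c W zero) (carryIn-tail W) (within ∘ suc) P-c)

    rippleOut-within : ∀ {P : Fin n → Set} k (W : AdderLayout n k) {cin} → (∀ i → P (s W i)) → (∀ i → P (c W i)) →
                       P cin → ∀ j → P (rippleOut k W cin j)
    adderOut-within : ∀ {P : Fin n → Set} k (W : AdderLayout n (suc k)) → (∀ i → P (s W i)) → (∀ i → P (c W i)) →
                      ∀ j → P (adderOut k W j)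

    rippleOut-within zero W P-s P-c P-cin zero = P-cin
    rippleOut-within {P} (suc k) W P-s P-c P-cin = adderOut-within {P} k W P-s P-c

    adderOut-within k W P-s P-c zero = P-s zero
    adderOut-within {P} k W P-s P-c (suc j) = rippleOut-within {P} k (tail W) (P-s ∘ suc) (P-c ∘ suc) (P-c zero) j

    length-ripple : ∀ k (W : AdderLayout n k) cin p → length (ripple k W cin p) ≡ 6 * k
    length-ripple zero W cin p = refl
    length-ripple (suc k) W cin p =
      trans (cong (6 +_) (length-ripple k (tail W) (c W zero) (carryIn-tail W))) (sym (*-suc 6 k))

    length-adder : ∀ k (W : AdderLayout n (suc k)) → length (adder k W) ≡ 3 + 6 * k
    length-adder k W = cong (3 +_) (length-ripple k (tail W) (c W zero) (carryIn-tail W))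

    open TwoBlockSpec

    ripple-spec : ∀ k (W : AdderLayout n k) cin (p : CarryIn W cin) {x y carry} S →
      x < 2 ^ k → y < 2 ^ k → Reads S (a W) (bitsLE k x) → Reads S (b W) (bitsLE k y) →
      lookup S cin ≡ carry → Zeroed S (s W) → Zeroed S (c W) →
      Reads (run (ripple k W cin p) S) (rippleOut k W cin) (bitsLE (suc k) (x + y + bitValue carry))

    -- the higher bits, once the stage on bit 0 (a half or a full adder) has written s₀ and c₀
    ripple-tail : ∀ k (W : AdderLayout n (suc k)) {x y} S S′ →
      x < 2 ^ suc k → y < 2 ^ suc k → Reads S (a W) (bitsLE (suc k) x) → Reads S (b W) (bitsLE (suc k) y) →
      Zeroed S (s W) → Zeroed S (c W) → (∀ {w} → w ≢ s W zero → w ≢ c W zero → lookup S′ w ≡ lookup S w) →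
      Reads (run (ripple k (tail W) (c W zero) (carryIn-tail W)) S′) (adderOut k W)
            (lookup S′ (s W zero) ∷ bitsLE (suc k) (x / 2 + y / 2 + bitValue (lookup S′ (c W zero))))

    ripple-spec zero W cin p {zero} {zero} {carry} S _ _ _ _ cin≡ _ _ zero = trans cin≡ (sym (lsb-bitValue carry))
    ripple-spec zero W cin p {zero} {suc _} S _ (s≤s ()) _ _ _ _ _
    ripple-spec zero W cin p {suc _} S (s≤s ()) _ _ _ _ _ _
    ripple-spec (suc k) W cin p {x} {y} {carry} S x< y< x-in y-in cin≡ s-zero c-zero i =
      trans (ripple-tail k W S S′ x< y< x-in y-in s-zero c-zero (elsewhere spec) i)
            (cong (λ v → lookup v i) (sym (bitsLE-+ (suc k) x y (bitValue carry) bits)))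
      where
      spec = fullAdder-spec W cin p S
      S′ = run (fullAdderCarry W cin p) (run (fullAdderSum W cin p) S)
      bits : bitValue (lsb x) + bitValue (lsb y) + bitValue carry ≡
             bitValue (lookup S′ (s W zero)) + bitValue (lookup S′ (c W zero)) * 2
      bits rewrite at-s spec | at-t spec | s-zero zero | c-zero zero | x-in zero | y-in zero | cin≡ =
        fullAdder-bits (lsb x) (lsb y) carry

    ripple-tail k W S S′ x< y< x-in y-in s-zero c-zero elsewhere zero =
      run-untouched (ripple k (tail W) (c W zero) (carryIn-tail W)) S′
        (ripple-within k (tail W) (c W zero) (carryIn-tail W)
          (λ i → a≢s W (suc i) zero ∘ sym , b≢s W (suc i) zero ∘ sym ,
                 Fin.0≢1+n ∘ s-injective W , s≢c W zero (suc i))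
          (s≢c W zero zero))
    ripple-tail k W {x} {y} S S′ x< y< x-in y-in s-zero c-zero elsewhere (suc j) =
      ripple-spec k (tail W) (c W zero) (carryIn-tail W) S′ (/2-< k x<) (/2-< k y<)
        (λ i → trans (elsewhere (a≢s W (suc i) zero) (a≢c W (suc i) zero)) (x-in (suc i)))
        (λ i → trans (elsewhere (b≢s W (suc i) zero) (b≢c W (suc i) zero)) (y-in (suc i)))
        refl
        (λ i → trans (elsewhere (Fin.0≢1+n ∘ s-injective W ∘ sym) (s≢c W (suc i) zero)) (s-zero (suc i)))
        (λ i → trans (elsewhere (s≢c W zero (suc i) ∘ sym) (Fin.0≢1+n ∘ c-injective W ∘ sym)) (c-zero (suc i)))
        j

    adder-spec : ∀ k (W : AdderLayout n (suc k)) {x y} S →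
      x < 2 ^ suc k → y < 2 ^ suc k → Reads S (a W) (bitsLE (suc k) x) → Reads S (b W) (bitsLE (suc k) y) →
      Zeroed S (s W) → Zeroed S (c W) →
      Reads (run (adder k W) S) (adderOut k W) (bitsLE (suc (suc k)) (x + y))
    adder-spec k W {x} {y} S x< y< x-in y-in s-zero c-zero i =
      trans (ripple-tail k W S S′ x< y< x-in y-in s-zero c-zero (elsewhere spec) i)
            (cong (λ v → lookup v i) (sym (trans (cong (bitsLE (suc (suc k))) (sym (+-identityʳ (x + y))))
                                                  (bitsLE-+ (suc k) x y 0 bits))))
      where
      spec = halfAdder-spec W S
      S′ = run (halfAdderCarry W) (run (halfAdderSum W) S)
      bits : bitValue (lsb x) + bitValue (lsb y) + 0 ≡
             bitValue (lookup S′ (s W zero)) + bitValue (lookup S′ (c W zero)) * 2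
      bits rewrite at-s spec | at-t spec | s-zero zero | c-zero zero | x-in zero | y-in zero =
        halfAdder-bits (lsb x) (lsb y)

  leaves : ℕ → ℕ
  leaves zero = 1
  leaves (suc m) = leaves m + leaves m

  -- the ancillas of both subtrees, then the sum and carry registers of the adder at the root
  ancillas : ℕ → ℕ
  ancillas zero = 0
  ancillas (suc m) = (ancillas m + ancillas m) + (suc m + suc m)

  record TreeLayout (n t h : ℕ) : Set where
    field
      input : Fin t → Fin n
      ancilla : Fin h → Fin n
      input-injective : Injective _≡_ _≡_ input
      ancilla-injective : Injective _≡_ _≡_ ancilla
      input≢ancilla : ∀ i j → input i ≢ ancilla j
  open TreeLayout

  Used : ∀ {n t h} → TreeLayout n t h → Fin n → Set
  Used L w = (∃ λ i → w ≡ input L i) ⊎ (∃ λ j → w ≡ ancilla L j)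

  module _ {n T H : ℕ} (L : TreeLayout n T H) where

    restrict : ∀ {t h} (ι : Fin t → Fin T) (κ : Fin h → Fin H) → Injective _≡_ _≡_ ι → Injective _≡_ _≡_ κ →
               TreeLayout n t h
    restrict ι κ ι-injective κ-injective = record
      { input = input L ∘ ι
      ; ancilla = ancilla L ∘ κ
      ; input-injective = ι-injective ∘ input-injective L
      ; ancilla-injective = κ-injective ∘ ancilla-injective L
      ; input≢ancilla = λ i j → input≢ancilla L (ι i) (κ j) }

    module _ {t h} {ι : Fin t → Fin T} {κ : Fin h → Fin H}
             {ι-inj : Injective _≡_ _≡_ ι} {κ-inj : Injective _≡_ _≡_ κ} where

      Used-restrict : ∀ {w} → Used (restrict ι κ ι-inj κ-inj) w → Used L w
      Used-restrict (inj₁ (i , w≡)) = inj₁ (ι i , w≡)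
      Used-restrict (inj₂ (j , w≡)) = inj₂ (κ j , w≡)

      Used-restrict-≢ancilla : ∀ {k w} → (∀ j → κ j ≢ k) → Used (restrict ι κ ι-inj κ-inj) w → w ≢ ancilla L k
      Used-restrict-≢ancilla _ (inj₁ (i , refl)) = input≢ancilla L (ι i) _
      Used-restrict-≢ancilla κ≢k (inj₂ (j , refl)) = κ≢k j ∘ ancilla-injective L

      Used-restrict-disjoint : ∀ {t′ h′} {ι′ : Fin t′ → Fin T} {κ′ : Fin h′ → Fin H}
        {ι′-inj : Injective _≡_ _≡_ ι′} {κ′-inj : Injective _≡_ _≡_ κ′} {w w′} →
        (∀ i i′ → ι i ≢ ι′ i′) → (∀ j j′ → κ j ≢ κ′ j′) →
        Used (restrict ι κ ι-inj κ-inj) w → Used (restrict ι′ κ′ ι′-inj κ′-inj) w′ → w ≢ w′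
      Used-restrict-disjoint ι≢ι′ _ (inj₁ (i , refl)) (inj₁ (i′ , refl)) = ι≢ι′ i i′ ∘ input-injective L
      Used-restrict-disjoint _ _ (inj₁ (i , refl)) (inj₂ (j′ , refl)) = input≢ancilla L _ _
      Used-restrict-disjoint _ _ (inj₂ (j , refl)) (inj₁ (i′ , refl)) = input≢ancilla L _ _ ∘ sym
      Used-restrict-disjoint _ κ≢κ′ (inj₂ (j , refl)) (inj₂ (j′ , refl)) = κ≢κ′ j j′ ∘ ancilla-injective L

  module Split (m : ℕ) where

    private
      t = leaves m
      h = ancillas m
      e = suc m

    inputˡ inputʳ : Fin t → Fin (leaves (suc m))
    inputˡ i = i ↑ˡ t
    inputʳ i = t ↑ʳ i

    ancillaˡ ancillaʳ : Fin h → Fin (ancillas (suc m))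
    ancillaˡ j = (j ↑ˡ h) ↑ˡ (e + e)
    ancillaʳ j = (h ↑ʳ j) ↑ˡ (e + e)

    root : Fin (e + e) → Fin (ancillas (suc m))
    root k = (h + h) ↑ʳ k

    sumBit carryBit : Fin e → Fin (ancillas (suc m))
    sumBit i = root (i ↑ˡ e)
    carryBit i = root (e ↑ʳ i)

    inputˡ-injective : Injective _≡_ _≡_ inputˡ
    inputˡ-injective = Fin.↑ˡ-injective t _ _
    inputʳ-injective : Injective _≡_ _≡_ inputʳ
    inputʳ-injective = Fin.↑ʳ-injective t _ _
    ancillaˡ-injective : Injective _≡_ _≡_ ancillaˡ
    ancillaˡ-injective = Fin.↑ˡ-injective h _ _ ∘ Fin.↑ˡ-injective (e + e) _ _
    ancillaʳ-injective : Injective _≡_ _≡_ ancillaʳ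
    ancillaʳ-injective = Fin.↑ʳ-injective h _ _ ∘ Fin.↑ˡ-injective (e + e) _ _
    sumBit-injective : Injective _≡_ _≡_ sumBit
    sumBit-injective = Fin.↑ˡ-injective e _ _ ∘ Fin.↑ʳ-injective (h + h) _ _
    carryBit-injective : Injective _≡_ _≡_ carryBit
    carryBit-injective = Fin.↑ʳ-injective e _ _ ∘ Fin.↑ʳ-injective (h + h) _ _

    inputˡ≢inputʳ : ∀ i j → inputˡ i ≢ inputʳ j
    inputˡ≢inputʳ = ↑ˡ≢↑ʳ
    ancillaˡ≢ancillaʳ : ∀ i j → ancillaˡ i ≢ ancillaʳ j
    ancillaˡ≢ancillaʳ i j = ↑ˡ≢↑ʳ i j ∘ Fin.↑ˡ-injective (e + e) _ _
    ancillaˡ≢root : ∀ i k → ancillaˡ i ≢ root k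
    ancillaˡ≢root i = ↑ˡ≢↑ʳ (i ↑ˡ h)
    ancillaʳ≢root : ∀ i k → ancillaʳ i ≢ root k
    ancillaʳ≢root i = ↑ˡ≢↑ʳ (h ↑ʳ i)
    sumBit≢carryBit : ∀ i j → sumBit i ≢ carryBit j
    sumBit≢carryBit i j = ↑ˡ≢↑ʳ i j ∘ Fin.↑ʳ-injective (h + h) _ _

  module _ {n : ℕ} (m : ℕ) (L : TreeLayout n (leaves (suc m)) (ancillas (suc m))) where
    open Split m

    left right : TreeLayout n (leaves m) (ancillas m)
    left = restrict L inputˡ ancillaˡ inputˡ-injective ancillaˡ-injective
    right = restrict L inputʳ ancillaʳ inputʳ-injective ancillaʳ-injective

    left-disjoint-right : ∀ {w w′} → Used left w → Used right w′ → w ≢ w′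
    left-disjoint-right = Used-restrict-disjoint L {ι-inj = inputˡ-injective} {ancillaˡ-injective}
      {ι′-inj = inputʳ-injective} {ancillaʳ-injective} inputˡ≢inputʳ ancillaˡ≢ancillaʳ

    left-≢root : ∀ {w} k → Used left w → w ≢ ancilla L (root k)
    left-≢root k = Used-restrict-≢ancilla L {ι-inj = inputˡ-injective} {ancillaˡ-injective} (λ j → ancillaˡ≢root j k)

    right-≢root : ∀ {w} k → Used right w → w ≢ ancilla L (root k)
    right-≢root k = Used-restrict-≢ancilla L {ι-inj = inputʳ-injective} {ancillaʳ-injective} (λ j → ancillaʳ≢root j k)

    left-used : ∀ {w} → Used left w → Used L w
    left-used = Used-restrict L {ι-inj = inputˡ-injective} {ancillaˡ-injective}

    right-used : ∀ {w} → Used right w → Used L w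
    right-used = Used-restrict L {ι-inj = inputʳ-injective} {ancillaʳ-injective}

    Used-root : ∀ k → Used L (ancilla L (root k))
    Used-root k = inj₂ (root k , refl)

  treeOut : ∀ {n} m → TreeLayout n (leaves m) (ancillas m) → Fin (suc m) → Fin n
  treeOut-used : ∀ {n} m (L : TreeLayout n (leaves m) (ancillas m)) j → Used L (treeOut m L j)
  rootAdder : ∀ {n} m → TreeLayout n (leaves (suc m)) (ancillas (suc m)) → AdderLayout n (suc m)

  treeOut zero L _ = input L zero
  treeOut (suc m) L = adderOut m (rootAdder m L)

  rootAdder m L = record
    { a = treeOut m (left m L)
    ; b = treeOut m (right m L)
    ; s = ancilla L ∘ sumBit
    ; c = ancilla L ∘ carryBit
    ; a≢b = λ i j → left-disjoint-right m L (a-used i) (b-used j)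
    ; a≢s = λ i j → left-≢root m L _ (a-used i)
    ; a≢c = λ i j → left-≢root m L _ (a-used i)
    ; b≢s = λ i j → right-≢root m L _ (b-used i)
    ; b≢c = λ i j → right-≢root m L _ (b-used i)
    ; s≢c = λ i j → sumBit≢carryBit i j ∘ ancilla-injective L
    ; s-injective = sumBit-injective ∘ ancilla-injective L
    ; c-injective = carryBit-injective ∘ ancilla-injective L }
    where
    open Split m
    a-used = treeOut-used m (left m L)
    b-used = treeOut-used m (right m L)

  treeOut-used zero L _ = inj₁ (zero , refl)
  treeOut-used (suc m) L =
    adderOut-within {P = Used L} m (rootAdder m L) (λ i → Used-root m L (i ↑ˡ suc m)) (λ i → Used-root m L (suc m ↑ʳ i))

  tree : ∀ {n} m → TreeLayout n (leaves m) (ancillas m) → Circuit n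
  tree zero L = []
  tree (suc m) L = (tree m (left m L) ++ tree m (right m L)) ++ adder m (rootAdder m L)

  popcount-++ : ∀ {p q} (u : Vec Bool p) (v : Vec Bool q) → popcount (u Vec.++ v) ≡ popcount u + popcount v
  popcount-++ [] v = refl
  popcount-++ (b ∷ u) v = trans (cong (bitValue b +_) (popcount-++ u v)) (sym (+-assoc (bitValue b) _ _))

  popcount≤length : ∀ {p} (u : Vec Bool p) → popcount u ≤ p
  popcount≤length [] = z≤n
  popcount≤length (true ∷ u) = s≤s (popcount≤length u)
  popcount≤length (false ∷ u) = m≤n⇒m≤1+n (popcount≤length u)

  leaves≡2^ : ∀ m → leaves m ≡ 2 ^ m
  leaves≡2^ zero = refl
  leaves≡2^ (suc m) = trans (cong (λ z → z + z) (leaves≡2^ m)) (cong (2 ^ m +_) (sym (+-identityʳ (2 ^ m))))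

  leaves<2^suc : ∀ m → leaves m < 2 ^ suc m
  leaves<2^suc m = subst (leaves m <_) (leaves≡2^ (suc m)) (m<m+n (leaves m) (positive m))
    where
    positive : ∀ m → 0 < leaves m
    positive zero = s≤s z≤n
    positive (suc m) = ≤-trans (positive m) (m≤m+n (leaves m) (leaves m))

  popcount<2^suc : ∀ m (u : Vec Bool (leaves m)) → popcount u < 2 ^ suc m
  popcount<2^suc m u = ≤-<-trans (popcount≤length u) (leaves<2^suc m)

  module _ {n : ℕ} where

    tree-within : ∀ m (L : TreeLayout n (leaves m) (ancillas m)) → ActsWithin (Used L) (tree m L)
    tree-within zero L = []
    tree-within (suc m) L = All.++⁺
      (All.++⁺ (ActsWithin-map (left-used m L) (tree-within m (left m L)))
               (ActsWithin-map (right-used m L) (tree-within m (right m L))))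
      (adder-within m (rootAdder m L) λ i →
        left-used m L (treeOut-used m _ i) , right-used m L (treeOut-used m _ i) , Used-root m L _ , Used-root m L _)

    tree-spec : ∀ m (L : TreeLayout n (leaves m) (ancillas m)) (bs : Vec Bool (leaves m)) S →
      Reads S (input L) bs → Zeroed S (ancilla L) →
      Reads (run (tree m L) S) (treeOut m L) (bitsLE (suc m) (popcount bs))
    tree-spec zero L (b ∷ []) S inputs _ zero =
      trans (inputs zero) (sym (trans (cong lsb (+-identityʳ (bitValue b))) (lsb-bitValue b)))
    tree-spec (suc m) L bs S inputs zeroed with Vec.splitAt (leaves m) bs
    ... | bsˡ , bsʳ , refl = λ i → begin
      lookup (run (tree (suc m) L) S) (adderOut m W i)
        ≡⟨ cong (λ S′ → lookup S′ (adderOut m W i)) run-tree ⟩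
      lookup (run (adder m W) Sʳ) (adderOut m W i)
        ≡⟨ adder-spec m W Sʳ (popcount<2^suc m bsˡ) (popcount<2^suc m bsʳ) a-reads b-reads s-zero c-zero i ⟩
      lookup (bitsLE (suc (suc m)) (popcount bsˡ + popcount bsʳ)) i
        ≡⟨ cong (λ z → lookup (bitsLE (suc (suc m)) z) i) (popcount-++ bsˡ bsʳ) ⟨
      lookup (bitsLE (suc (suc m)) (popcount (bsˡ Vec.++ bsʳ))) i ∎
      where
      open ≡-Reasoning
      W = rootAdder m L
      Sˡ = run (tree m (left m L)) S
      Sʳ = run (tree m (right m L)) Sˡ
      run-tree : run (tree (suc m) L) S ≡ run (adder m W) Sʳ
      run-tree = trans (run-++ (tree m (left m L) ++ tree m (right m L)) (adder m W) S)
                       (cong (run (adder m W)) (run-++ (tree m (left m L)) (tree m (right m L)) S))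
      leftUnused : ∀ {w} → (∀ {v} → Used (left m L) v → v ≢ w) → lookup Sˡ w ≡ lookup S w
      leftUnused = run-outside (tree m (left m L)) S (tree-within m (left m L))
      rightUnused : ∀ {w} → (∀ {v} → Used (right m L) v → v ≢ w) → lookup Sʳ w ≡ lookup Sˡ w
      rightUnused = run-outside (tree m (right m L)) Sˡ (tree-within m (right m L))
      a-reads : Reads Sʳ (a W) (bitsLE (suc m) (popcount bsˡ))
      a-reads i = trans (rightUnused (λ usedʳ → left-disjoint-right m L (treeOut-used m _ i) usedʳ ∘ sym))
        (tree-spec m (left m L) bsˡ S (λ j → trans (inputs _) (Vec.lookup-++ˡ bsˡ bsʳ j)) (zeroed ∘ _) i)
      b-reads : Reads Sʳ (b W) (bitsLE (suc m) (popcount bsʳ))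
      b-reads = tree-spec m (right m L) bsʳ Sˡ
        (λ j → trans (leftUnused (λ usedˡ → left-disjoint-right m L usedˡ (inj₁ (j , refl))))
                     (trans (inputs _) (Vec.lookup-++ʳ bsˡ bsʳ j)))
        (λ j → trans (leftUnused (λ usedˡ → left-disjoint-right m L usedˡ (inj₂ (j , refl)))) (zeroed _))
      rootUnused : ∀ k → lookup Sʳ (ancilla L (Split.root m k)) ≡ false
      rootUnused k = trans (rightUnused (right-≢root m L k)) (trans (leftUnused (left-≢root m L k)) (zeroed _))
      s-zero : Zeroed Sʳ (s W)
      s-zero i = rootUnused _
      c-zero : Zeroed Sʳ (c W)
      c-zero i = rootUnused _

  treeDepth : ℕ → ℕ
  treeDepth zero = 0
  treeDepth (suc m) = treeDepth m + (3 + 6 * m)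

  treeSize : ℕ → ℕ
  treeSize zero = 0
  treeSize (suc m) = (treeSize m + treeSize m) + (3 + 6 * m)

  module _ {n : ℕ} where

    private
      adder-LevelBound : ∀ m (W : AdderLayout n (suc m)) → LevelBound (adder m W) (3 + 6 * m)
      adder-LevelBound m W = subst (LevelBound (adder m W)) (length-adder m W) (LevelBound-length (adder m W))

      depth-step : ∀ m → (treeDepth m ⊔ treeDepth m) + (3 + 6 * m) ≡ treeDepth (suc m)
      depth-step m = cong (_+ (3 + 6 * m)) (⊔-idem (treeDepth m))

    tree-LevelBound : ∀ m (L : TreeLayout n (leaves m) (ancillas m)) → LevelBound (tree m L) (treeDepth m)
    tree-LevelBound zero L = LevelBound-length []
    tree-LevelBound (suc m) L = subst (LevelBound (tree (suc m) L)) (depth-step m)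
      (LevelBound-++
        (LevelBound-parallel (λ usedˡ usedʳ → left-disjoint-right m L usedˡ usedʳ refl)
          (tree-within m (left m L)) (tree-within m (right m L))
          (tree-LevelBound m (left m L)) (tree-LevelBound m (right m L)))
        (adder-LevelBound m (rootAdder m L)))

    tree-reverse-LevelBound : ∀ m (L : TreeLayout n (leaves m) (ancillas m)) → LevelBound (reverse (tree m L)) (treeDepth m)
    tree-reverse-LevelBound zero L = LevelBound-length []
    tree-reverse-LevelBound (suc m) L = subst₂ LevelBound (sym reverse-tree) (trans (+-comm (3 + 6 * m) _) (depth-step m))
      (LevelBound-++
        (subst (LevelBound (reverse A)) (trans (List.length-reverse A) (length-adder m W)) (LevelBound-length (reverse A)))
        (LevelBound-parallel (λ usedʳ usedˡ → left-disjoint-right m L usedˡ usedʳ refl)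
          (ActsWithin-reverse (tree-within m (right m L))) (ActsWithin-reverse (tree-within m (left m L)))
          (tree-reverse-LevelBound m (right m L)) (tree-reverse-LevelBound m (left m L))))
      where
      W = rootAdder m L
      A = adder m W
      Tˡ = tree m (left m L)
      Tʳ = tree m (right m L)
      reverse-tree : reverse ((Tˡ ++ Tʳ) ++ A) ≡ reverse A ++ (reverse Tʳ ++ reverse Tˡ)
      reverse-tree = trans (List.reverse-++ (Tˡ ++ Tʳ) A) (cong (reverse A ++_) (List.reverse-++ Tˡ Tʳ))

    length-tree : ∀ m (L : TreeLayout n (leaves m) (ancillas m)) → length (tree m L) ≡ treeSize m
    length-tree zero L = refl
    length-tree (suc m) L = begin
      length ((Tˡ ++ Tʳ) ++ adder m (rootAdder m L))
        ≡⟨ List.length-++ (Tˡ ++ Tʳ) ⟩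
      length (Tˡ ++ Tʳ) + length (adder m (rootAdder m L))
        ≡⟨ cong₂ _+_ (List.length-++ Tˡ) (length-adder m (rootAdder m L)) ⟩
      (length Tˡ + length Tʳ) + (3 + 6 * m)
        ≡⟨ cong (_+ (3 + 6 * m)) (cong₂ _+_ (length-tree m _) (length-tree m _)) ⟩
      (treeSize m + treeSize m) + (3 + 6 * m) ∎
      where
      open ≡-Reasoning
      Tˡ = tree m (left m L)
      Tʳ = tree m (right m L)

  treeSize+6m+9 : ∀ m → treeSize m + (6 * m + 9) ≡ 9 * leaves m
  treeSize+6m+9 zero = refl
  treeSize+6m+9 (suc m) = trans (regroup (treeSize m) m)
    (trans (cong (λ z → z + z) (treeSize+6m+9 m)) (sym (*-distribˡ-+ 9 (leaves m) (leaves m))))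
    where
    regroup : ∀ l m → ((l + l) + (3 + 6 * m)) + (6 * suc m + 9) ≡ (l + (6 * m + 9)) + (l + (6 * m + 9))
    regroup = solve-∀

  treeDepth≡3m² : ∀ m → treeDepth m ≡ 3 * (m * m)
  treeDepth≡3m² zero = refl
  treeDepth≡3m² (suc m) = trans (cong (_+ (3 + 6 * m)) (treeDepth≡3m² m)) (square m)
    where
    square : ∀ m → 3 * (m * m) + (3 + 6 * m) ≡ 3 * (suc m * suc m)
    square = solve-∀

  ancillas+2m+4 : ∀ m → ancillas m + (2 * m + 4) ≡ 4 * leaves m
  ancillas+2m+4 zero = refl
  ancillas+2m+4 (suc m) = trans (regroup (ancillas m) m)
    (trans (cong (λ z → z + z) (ancillas+2m+4 m)) (sym (*-distribˡ-+ 4 (leaves m) (leaves m))))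
    where
    regroup : ∀ w m → ((w + w) + (suc m + suc m)) + (2 * suc m + 4) ≡ (w + (2 * m + 4)) + (w + (2 * m + 4))
    regroup = solve-∀

  ancillas≡hOf : ∀ m → ancillas m ≡ hOf m
  ancillas≡hOf m = sym (begin
    4 * 2 ^ m ∸ 2 * m ∸ 4                  ≡⟨ ∸-+-assoc (4 * 2 ^ m) (2 * m) 4 ⟩
    4 * 2 ^ m ∸ (2 * m + 4)                ≡⟨ cong (λ z → 4 * z ∸ (2 * m + 4)) (leaves≡2^ m) ⟨
    4 * leaves m ∸ (2 * m + 4)             ≡⟨ cong (_∸ (2 * m + 4)) (ancillas+2m+4 m) ⟨
    ancillas m + (2 * m + 4) ∸ (2 * m + 4) ≡⟨ m+n∸n≡m (ancillas m) (2 * m + 4) ⟩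
    ancillas m                             ∎)
    where open ≡-Reasoning

  module _ {n : ℕ} where

    copy : ∀ k (src dst : Fin k → Fin n) → (∀ i j → src i ≢ dst j) → Circuit n
    copy zero src dst _ = []
    copy (suc k) src dst src≢dst =
      CNOT (src zero) (dst zero) (src≢dst zero zero) ∷ copy k (src ∘ suc) (dst ∘ suc) (λ i j → src≢dst (suc i) (suc j))

    length-copy : ∀ k src dst src≢dst → length (copy k src dst src≢dst) ≡ k
    length-copy zero src dst _ = refl
    length-copy (suc k) src dst src≢dst = cong suc (length-copy k (src ∘ suc) (dst ∘ suc) _)

    copy-frame : ∀ k src dst src≢dst S {w} → (∀ i → w ≢ dst i) → lookup (run (copy k src dst src≢dst) S) w ≡ lookup S w
    copy-frame k src dst src≢dst S w≢dst = run-frame (copy k src dst src≢dst) S (targets k src dst src≢dst w≢dst)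
      where
      targets : ∀ {w} k src dst src≢dst → (∀ i → w ≢ dst i) → All ((w ≢_) ∘ target) (copy k src dst src≢dst)
      targets zero _ _ _ _ = []
      targets (suc k) src dst _ w≢dst = w≢dst zero ∷ targets k (src ∘ suc) (dst ∘ suc) _ (w≢dst ∘ suc)

    copy-spec : ∀ k src dst src≢dst → Injective _≡_ _≡_ dst → ∀ S j →
      lookup (run (copy k src dst src≢dst) S) (dst j) ≡ lookup S (dst j) xor lookup S (src j)
    copy-spec (suc k) src dst src≢dst dst-injective S zero =
      trans (copy-frame k (src ∘ suc) (dst ∘ suc) _ _ (λ i → Fin.0≢1+n ∘ dst-injective))
            (applyGate-target (CNOT (src zero) (dst zero) (src≢dst zero zero)) S)
    copy-spec (suc k) src dst src≢dst dst-injective S (suc j) =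
      trans (copy-spec k (src ∘ suc) (dst ∘ suc) _ (Fin.suc-injective ∘ dst-injective) (applyGate g S) j)
            (cong₂ _xor_ (applyGate-≢target g S (Fin.0≢1+n ∘ dst-injective ∘ sym)) (applyGate-≢target g S (src≢dst (suc j) zero)))
      where g = CNOT (src zero) (dst zero) (src≢dst zero zero)

  -- lemma4 with t and h abstracted: leaves m and ancillas m equal tOf m and hOf m only propositionally
  PopcountCircuit : ℕ → ℕ → ℕ → Set
  PopcountCircuit m t h = Σ (Circuit (t + (h + kOf m))) λ U →
    (∀ (b : Vec Bool t) →
      run U (b Vec.++ Vec.replicate h false Vec.++ Vec.replicate (kOf m) false)
        ≡ b Vec.++ Vec.replicate h false Vec.++ toBits (kOf m) (popcount b))
    × (1 ≤ m →
        (complexity U ≤ 27 * tOf m)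
        × DepthAtMost U (27 * (m * m))
        × WidthAtMost U (27 * tOf m))

  module _ (m : ℕ) where

    private
      t = leaves m
      h = ancillas m
      k = kOf m

    inputWire : Fin t → Fin (t + (h + k))
    inputWire i = i ↑ˡ (h + k)

    ancillaWire : Fin h → Fin (t + (h + k))
    ancillaWire j = t ↑ʳ (j ↑ˡ k)

    outWire : Fin k → Fin (t + (h + k))
    outWire l = t ↑ʳ (h ↑ʳ l)

    layout : TreeLayout (t + (h + k)) t h
    layout = record
      { input = inputWire
      ; ancilla = ancillaWire
      ; input-injective = Fin.↑ˡ-injective (h + k) _ _
      ; ancilla-injective = Fin.↑ˡ-injective k _ _ ∘ Fin.↑ʳ-injective t _ _
      ; input≢ancilla = λ i j → ↑ˡ≢↑ʳ i (j ↑ˡ k) }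

    Used≢outWire : ∀ {w} → Used layout w → ∀ l → w ≢ outWire l
    Used≢outWire (inj₁ (i , refl)) l = ↑ˡ≢↑ʳ i (h ↑ʳ l)
    Used≢outWire (inj₂ (j , refl)) l = ↑ˡ≢↑ʳ j l ∘ Fin.↑ʳ-injective t _ _

    -- toBits is most significant bit first, the tree's output least significant bit first
    copyDst : Fin k → Fin (t + (h + k))
    copyDst j = outWire (Fin.opposite j)

    copyDst-injective : Injective _≡_ _≡_ copyDst
    copyDst-injective {i} {j} eq = trans (sym (Fin.opposite-involutive i))
      (trans (cong Fin.opposite (Fin.↑ʳ-injective h _ _ (Fin.↑ʳ-injective t _ _ eq))) (Fin.opposite-involutive j))

    treeOut≢copyDst : ∀ i j → treeOut m layout i ≢ copyDst j
    treeOut≢copyDst i j = Used≢outWire (treeOut-used m layout i) _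

    copyOut : Circuit (t + (h + k))
    copyOut = copy k (treeOut m layout) copyDst treeOut≢copyDst

    popcountCircuit : Circuit (t + (h + k))
    popcountCircuit = tree m layout ++ (copyOut ++ reverse (tree m layout))

    outWire-untouched : ∀ c → ActsWithin (Used layout) c → ∀ S l → lookup (run c S) (outWire l) ≡ lookup S (outWire l)
    outWire-untouched c within S l = run-outside c S within (λ used → Used≢outWire used l)

    module _ (b : Vec Bool t) where

      private
        T = tree m layout
        S₀ = b Vec.++ Vec.replicate h false Vec.++ Vec.replicate k false
        S₁ = run T S₀
        S₂ = run copyOut S₁

      initial-ancilla : ∀ j → lookup S₀ (ancillaWire j) ≡ false
      initial-ancilla j = trans (Vec.lookup-++ʳ b _ (j ↑ˡ k))
        (trans (Vec.lookup-++ˡ (Vec.replicate h false) _ j) (Vec.lookup-replicate j false))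

      initial-out : ∀ l → lookup S₀ (outWire l) ≡ false
      initial-out l = trans (Vec.lookup-++ʳ b _ (h ↑ʳ l))
        (trans (Vec.lookup-++ʳ (Vec.replicate h false) _ l) (Vec.lookup-replicate l false))

      -- the copy leaves the tree's wires alone, so reverse T undoes T on them
      uncomputed : ∀ {w} → Used layout w → lookup (run (reverse T) S₂) w ≡ lookup S₀ w
      uncomputed used =
        trans (run-local (reverse T) (ActsWithin-map copy-keeps (ActsWithin-reverse (tree-within m layout))) (copy-keeps used))
              (cong (λ S → lookup S _) (run-reverse T S₀))
        where
        copy-keeps : ∀ {w} → Used layout w → Agree S₂ S₁ w
        copy-keeps used = copy-frame k (treeOut m layout) copyDst treeOut≢copyDst S₁ (λ i → Used≢outWire used _)

      copied : ∀ j → lookup S₂ (copyDst j) ≡ lookup (toBits k (popcount b)) (Fin.opposite j)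
      copied j = begin
        lookup S₂ (copyDst j)
          ≡⟨ copy-spec k (treeOut m layout) copyDst treeOut≢copyDst copyDst-injective S₁ j ⟩
        lookup S₁ (copyDst j) xor lookup S₁ (treeOut m layout j)
          ≡⟨ cong (_xor lookup S₁ (treeOut m layout j)) still-false ⟩
        lookup S₁ (treeOut m layout j)
          ≡⟨ tree-spec m layout b S₀ (Vec.lookup-++ˡ b _) initial-ancilla j ⟩
        lookup (bitsLE k (popcount b)) j
          ≡⟨ lookup-toBits k (popcount b) j ⟨
        lookup (toBits k (popcount b)) (Fin.opposite j) ∎
        where
        open ≡-Reasoning
        still-false : lookup S₁ (copyDst j) ≡ false
        still-false = trans (outWire-untouched T (tree-within m layout) S₀ _) (initial-out _)

      popcountCircuit-correct : run popcountCircuit S₀ ≡ b Vec.++ Vec.replicate h false Vec.++ toBits k (popcount b)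
      popcountCircuit-correct = begin
        run popcountCircuit S₀   ≡⟨ run-++ T (copyOut ++ reverse T) S₀ ⟩
        run (copyOut ++ reverse T) S₁ ≡⟨ run-++ copyOut (reverse T) S₁ ⟩
        run (reverse T) S₂       ≡⟨ ≡-++-++ _ b (Vec.replicate h false) (toBits k (popcount b)) input-value ancilla-value out-value ⟩
        b Vec.++ Vec.replicate h false Vec.++ toBits k (popcount b) ∎
        where
        open ≡-Reasoning
        input-value : ∀ i → lookup (run (reverse T) S₂) (inputWire i) ≡ lookup b i
        input-value i = trans (uncomputed (inj₁ (i , refl))) (Vec.lookup-++ˡ b _ i)
        ancilla-value : ∀ j → lookup (run (reverse T) S₂) (ancillaWire j) ≡ lookup (Vec.replicate h false) j
        ancilla-value j = trans (uncomputed (inj₂ (j , refl))) (trans (initial-ancilla j) (sym (Vec.lookup-replicate j false)))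
        out-value : ∀ l → lookup (run (reverse T) S₂) (outWire l) ≡ lookup (toBits k (popcount b)) l
        out-value l = subst (λ l′ → lookup (run (reverse T) S₂) (outWire l′) ≡ lookup (toBits k (popcount b)) l′)
          (Fin.opposite-involutive l)
          (trans (outWire-untouched (reverse T) (ActsWithin-reverse (tree-within m layout)) S₂ _) (copied (Fin.opposite l)))

    length-popcountCircuit : length popcountCircuit ≡ treeSize m + (k + treeSize m)
    length-popcountCircuit = begin
      length (T ++ (copyOut ++ reverse T))
        ≡⟨ trans (List.length-++ T) (cong (length T +_) (List.length-++ copyOut)) ⟩
      length T + (length copyOut + length (reverse T))
        ≡⟨ cong₂ _+_ (length-tree m layout) (cong₂ _+_ (length-copy k _ copyDst treeOut≢copyDst)
                                                         (trans (List.length-reverse T) (length-tree m layout))) ⟩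
      treeSize m + (k + treeSize m) ∎
      where
      open ≡-Reasoning
      T = tree m layout

    popcountCircuit-LevelBound : LevelBound popcountCircuit (treeDepth m + (k + treeDepth m))
    popcountCircuit-LevelBound = LevelBound-++ (tree-LevelBound m layout)
      (LevelBound-++ (subst (LevelBound copyOut) (length-copy k _ copyDst treeOut≢copyDst) (LevelBound-length copyOut))
                     (tree-reverse-LevelBound m layout))

    complexity-bound : treeSize m + (k + treeSize m) ≤ 27 * 2 ^ m
    complexity-bound = begin
      treeSize m + (suc m + treeSize m)   ≤⟨ ≤-by-slack (treeSize m + 17 * m + 26) (slack (treeSize m) m) ⟩
      3 * (treeSize m + (6 * m + 9))      ≡⟨ cong (3 *_) (trans (treeSize+6m+9 m) (cong (9 *_) (leaves≡2^ m))) ⟩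
      3 * (9 * 2 ^ m)                     ≡⟨ *-assoc 3 9 (2 ^ m) ⟨
      27 * 2 ^ m                          ∎
      where
      open ≤-Reasoning
      slack : ∀ s m → s + (suc m + s) + (s + 17 * m + 26) ≡ 3 * (s + (6 * m + 9))
      slack = solve-∀

  depth-bound : ∀ m → 1 ≤ m → treeDepth m + (kOf m + treeDepth m) ≤ 27 * (m * m)
  depth-bound (suc m) _ rewrite treeDepth≡3m² (suc m) = ≤-by-slack (21 * (m * m) + 41 * m + 19) (slack m)
    where
    slack : ∀ m → 3 * (suc m * suc m) + (suc (suc m) + 3 * (suc m * suc m)) + (21 * (m * m) + 41 * m + 19)
                  ≡ 27 * (suc m * suc m)
    slack = solve-∀

  popcountCircuit-spec : ∀ m → PopcountCircuit m (leaves m) (ancillas m)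
  popcountCircuit-spec m = popcountCircuit m , popcountCircuit-correct m , λ 1≤m →
      size-bound
    , (λ path linked → ≤-trans (LevelBound⇒DepthAtMost (popcountCircuit-LevelBound m) path linked) (depth-bound m 1≤m))
    , WidthAtMost-complexity (popcountCircuit m) size-bound
    where
    size-bound : complexity (popcountCircuit m) ≤ 27 * tOf m
    size-bound = subst (_≤ 27 * tOf m) (sym (length-popcountCircuit m)) (complexity-bound m)

open import Data.Bool using (Bool; false)
open import Data.Nat using (ℕ; _+_; _*_; _≤_)
open import Data.Vec using (Vec; _++_; replicate)
open import Data.Product using (Σ; ∃; _×_; _,_)
open import Relation.Binary.PropositionalEquality using (_≡_; subst₂)
open AdderTree using (PopcountCircuit; popcountCircuit-spec; leaves≡2^; ancillas≡hOf)

lemma4 : ∃ λ (C : ℕ) → ∃ λ (N : ℕ) → ∀ (m : ℕ) →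
    Σ (Circuit (tOf m + (hOf m + kOf m))) λ U →
      (∀ (b : Vec Bool (tOf m)) →
        run U (b ++ replicate (hOf m) false ++ replicate (kOf m) false)
          ≡ b ++ replicate (hOf m) false ++ toBits (kOf m) (popcount b))
      × (N ≤ m →
          (complexity U ≤ C * tOf m)
          × DepthAtMost U (C * (m * m))
          × WidthAtMost U (C * tOf m))
lemma4 = 27 , 1 , λ m → subst₂ (PopcountCircuit m) (leaves≡2^ m) (ancillas≡hOf m) (popcountCircuit-spec m)
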